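{- Let $\Gamma$, $d$ and $b_{m,k}$ be as in the context, and let $x_1,\dots,x_d$ be indeterminates; set $x_0=1$. Define polynomials $r_m=r_m(x_1,\dots,x_d,z)$ for $1\le m\le d+1$ by $r_1=1$ and, for $1\le m\le d$, \[ r_{m+1}=r_m+x_mz^m-\sum_{k=0}^{m-1}b_{m,k}z^{m-k}r_{k+1}. \] Then for $1\le m\le d+1$, \[ r_m=\sum_{i=0}^{m-1}\sum_{j=0}^{i}\left(\sum_{\substack{j\le s_1<t_1\le s_2<t_2\le\dots\le s_n<t_n\le m-1\\(t_1-s_1)+\dots+(t_n-s_n)=i-j}}(-1)^nb_{t_1,s_1}\cdots b_{t_n,s_n}\right)x_jz^i, \] where the inner sum runs over all $n\ge0$ and all such integer sequences, the term with $n=0$ (possible only when $i=j$) contributing $1$.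
   Context: $\Gamma$ is a finite link-regular simplicial graph (cliques of equal size have links of equal size) with maximum clique size $d$; $\ell_0=|V\Gamma|$ and $\ell_k=|\mathrm{Lk}(\sigma)|$ for any $k$-clique $\sigma$, where $\mathrm{Lk}(\sigma)=\{v\notin\sigma\mid\sigma\cup\{v\}\text{ is a clique}\}$. Set $b_{0,0}=1$ and $b_{m,k}=\binom{m}{k}N_{m,k}$ for $1\le m\le d$, $0\le k\le m$, where $N_{m,m}=1$, $N_{m,m-1}=\ell_{m-1}-\ell_m-1$, and $N_{m,k}=\left(\prod_{k<j<m}\ell_j\right)\sum_{j=k}^m\binom{m-k}{j-k}(-1)^{j-k}\ell_j$ for $k<m-1$. -}

module Defs where

open import Level using (Level)
open import Data.Bool using (Bool; true; false; _∧_; _∨_; not; if_then_else_)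
open import Data.Nat as ℕ using (ℕ; zero; suc; _∸_; _≤ᵇ_; _<ᵇ_; _≡ᵇ_)
open import Data.Integer as ℤ using (ℤ; +_; -[1+_])
open import Data.Fin using (Fin; _≟_)
open import Data.Fin.Subset using (Subset; ⁅_⁆; _∪_)
open import Data.Vec using (lookup)
open import Data.List using (List; []; _∷_; map; concatMap; upTo; filter; length; foldr)
open import Data.List.Base using (allFin)
open import Data.Nat.Combinatorics using (_C_)
open import Data.Product using (_×_; _,_)
open import Relation.Nullary using (does)
open import Relation.Nullary.Decidable using (⌊_⌋)
open import Relation.Binary.PropositionalEquality using (_≡_)
open import Algebra.Bundles using (CommutativeRing)

allᵇ : {A : Set} → (A → Bool) → List A → Bool
allᵇ p [] = true
allᵇ p (a ∷ as) = p a ∧ allᵇ p as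

record Graph : Set where
  field
    n      : ℕ
    adj    : Fin n → Fin n → Bool
    sym    : ∀ u v → adj u v ≡ adj v u
    irrefl : ∀ v → adj v v ≡ false

module GraphDefs (Γ : Graph) where
  open Graph Γ

  memᵇ : Fin n → Subset n → Bool
  memᵇ v σ = lookup σ v

  cliqueᵇ : Subset n → Bool
  cliqueᵇ σ = allᵇ (λ u → allᵇ (λ v →
      not (memᵇ u σ ∧ memᵇ v σ) ∨ does (u ≟ v) ∨ adj u v) (allFin n)) (allFin n)

  IsClique : Subset n → Set
  IsClique σ = cliqueᵇ σ ≡ true

  Lk : Subset n → List (Fin n)
  Lk σ = filter (λ v → (not (memᵇ v σ) ∧ cliqueᵇ (σ ∪ ⁅ v ⁆)) Data.Bool.≟ true) (allFin n)

  linkSize : Subset n → ℕ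
  linkSize σ = length (Lk σ)

range : ℕ → ℕ → List ℕ
range a b = map (λ i → a ℕ.+ i) (upTo (b ∸ a))

sumℤ : List ℤ → ℤ
sumℤ = foldr ℤ._+_ (+ 0)

prodℤ : List ℤ → ℤ
prodℤ = foldr ℤ._*_ (+ 1)

N : (ℕ → ℕ) → ℕ → ℕ → ℤ
N ℓ m k =
  if k ≡ᵇ m then + 1
  else if suc k ≡ᵇ m then (+ ℓ (m ∸ 1)) ℤ.- (+ ℓ m) ℤ.- (+ 1)
  else prodℤ (map (λ j → + ℓ j) (range (suc k) m))
       ℤ.* sumℤ (map (λ i → (+ ((m ∸ k) C i)) ℤ.* (ℤ.-1ℤ ℤ.^ i) ℤ.* (+ ℓ (k ℕ.+ i)))
                     (upTo (suc (m ∸ k))))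

-- b_{0,0} = 1, b_{m,k} = C(m,k) N_{m,k} for 1 ≤ m, 0 ≤ k ≤ m
-- (value 0 outside this range; never used there)
b : (ℕ → ℕ) → ℕ → ℕ → ℤ
b ℓ zero zero = + 1
b ℓ zero (suc k) = + 0
b ℓ (suc m) k = if k ≤ᵇ suc m then (+ (suc m C k)) ℤ.* N ℓ (suc m) k else + 0

listsOf : {A : Set} → ℕ → List A → List (List A)
listsOf zero xs = [] ∷ []
listsOf (suc k) xs = concatMap (λ a → map (a ∷_) (listsOf k xs)) xs

pairsUpTo : ℕ → List (ℕ × ℕ)
pairsUpTo M = concatMap (λ s → map (λ t → (s , t)) (upTo (suc M))) (upTo (suc M))

chainᵇ : ℕ → ℕ → List (ℕ × ℕ) → Bool
chainᵇ a M [] = true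
chainᵇ a M ((s , t) ∷ ps) = (a ≤ᵇ s) ∧ (s <ᵇ t) ∧ (t ≤ᵇ M) ∧ chainᵇ t M ps

weight : List (ℕ × ℕ) → ℕ
weight [] = 0
weight ((s , t) ∷ ps) = (t ∸ s) ℕ.+ weight ps

module RingDefs {c ℓr : Level} (R : CommutativeRing c ℓr) where
  open CommutativeRing R

  sumR : List Carrier → Carrier
  sumR = foldr _+_ 0#

  prodR : List Carrier → Carrier
  prodR = foldr _*_ 1#

  powR : Carrier → ℕ → Carrier
  powR y zero = 1#
  powR y (suc k) = y * powR y k

  sgnR : ℕ → Carrier
  sgnR zero = 1#
  sgnR (suc k) = - sgnR k

  natR : ℕ → Carrier
  natR zero = 0#
  natR (suc k) = 1# + natR k

  intR : ℤ → Carrier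
  intR (+ k) = natR k
  intR -[1+ k ] = - natR (suc k)

  xx : (ℕ → Carrier) → ℕ → Carrier
  xx x zero = 1#
  xx x (suc j) = x (suc j)

  recSum : (ℕ → ℕ) → Carrier → (ℕ → Carrier) → ℕ → Carrier
  recSum ℓ z r m = sumR (map (λ k → intR (b ℓ m k) * powR z (m ∸ k) * r (suc k)) (upTo m))

  -- The coefficient
  --   Σ_{n ≥ 0} Σ_{j ≤ s₁ < t₁ ≤ … ≤ sₙ < tₙ ≤ m-1, Σ (tᵢ - sᵢ) = i - j}
  --       (-1)^n b_{t₁,s₁} ⋯ b_{tₙ,sₙ}
  -- (n ranges over 0..m; longer chains cannot satisfy the constraints)
  coeff : (ℕ → ℕ) → ℕ → ℕ → ℕ → Carrier
  coeff ℓ m i j =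
    sumR (map (λ n →
      sumR (map (λ ps → sgnR n * prodR (map (λ { (s , t) → intR (b ℓ t s) }) ps))
                (filter (λ ps → (chainᵇ j (m ∸ 1) ps ∧ (weight ps ≡ᵇ (i ∸ j))) Data.Bool.≟ true)
                        (listsOf n (pairsUpTo (m ∸ 1))))))
      (upTo (suc m)))

  closedForm : (ℕ → ℕ) → (ℕ → Carrier) → Carrier → ℕ → Carrier
  closedForm ℓ x z m =
    sumR (map (λ i → sumR (map (λ j → coeff ℓ m i j * xx x j * powR z i) (upTo (suc i))))
              (upTo m))

-- Put φ(s,t) = -b_{t,s} z^{t-s}, so that the recursion reads
-- r_{m+1} = r_m + x_m z^m + Σ_{k<m} φ(k,m) r_{k+1}. Grouping the closed form by j, the coefficient of x_j is
-- z^j T_M(j) with M = m - 1, where T_M(j) is the sum of φ(s₁,t₁)⋯φ(sₙ,tₙ) over all chains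
-- j ≤ s₁ < t₁ ≤ ⋯ ≤ sₙ < tₙ ≤ M. Splitting off the last pair of a chain gives
-- T_{M+1}(j) = T_M(j) + Σ_{j≤k≤M} T_k(j) φ(k,M+1), hence Σ_j x_j z^j T_M(j) obeys the same recursion as r_{M+1}
-- and the two agree by induction. Chain sums are built from the first pair, as the enumeration in the closed
-- form is, so the last-pair splitting is itself an induction on the number of pairs.

module Submission where

open import Defs
open import Level using (Level)
open import Data.Nat using (ℕ; suc; _≤_)
open import Data.Fin.Subset using (Subset; ∣_∣)
open import Data.Product using (Σ; _×_)
open import Relation.Binary.PropositionalEquality using (_≡_)
open import Algebra.Bundles using (CommutativeRing)

open import Data.Bool using (Bool; true; false; _∧_; T)
import Data.Bool
open import Data.Bool.Properties using (T-∧)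
open import Data.Empty using (⊥-elim)
open import Data.List using (List; []; _∷_; map; concatMap; upTo; filter; _++_)
import Data.List.Properties as Listₚ
open import Data.Nat as ℕ using (zero; _<_; _∸_; _≤′_; ≤′-reflexive; ≤′-step; _≤ᵇ_; _<ᵇ_; _≡ᵇ_; z≤n; s≤s)
import Data.Nat.Properties as ℕₚ
open import Data.Product using (_,_)
open import Data.Sum using (inj₁; inj₂)
open import Data.Unit using (tt)
open import Function using (_∘_; const)
open import Function.Bundles using (Equivalence)
open import Relation.Binary.PropositionalEquality as ≡ using (_≢_)
open import Relation.Nullary using (¬_)

module Sums {c ℓr : Level} (R : CommutativeRing c ℓr) where
  open CommutativeRing R hiding (zero)
  open RingDefs R using (sumR)
  open import Relation.Binary.Reasoning.Setoid setoid
  open import Algebra.Properties.AbelianGroup +-abelianGroup using (⁻¹-∙-comm)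
  open import Algebra.Properties.Group +-group using (ε⁻¹≈ε)
  open import Algebra.Properties.CommutativeSemigroup +-commutativeSemigroup using (interchange)

  private variable A B : Set

  ∑ : List A → (A → Carrier) → Carrier
  ∑ xs f = sumR (map f xs)

  infix 5 ∑ ∑<
  syntax ∑ xs (λ x → e) = ∑[ x ∈ xs ] e

  ∑< : ℕ → (ℕ → Carrier) → Carrier
  ∑< n = ∑ (upTo n)

  syntax ∑< n (λ i → e) = ∑[ i < n ] e

  ∑-cong : (xs : List A) {f g : A → Carrier} → (∀ x → f x ≈ g x) → ∑ xs f ≈ ∑ xs g
  ∑-cong []       f≈g = refl
  ∑-cong (x ∷ xs) f≈g = +-cong (f≈g x) (∑-cong xs f≈g)

  ∑-++ : (xs ys : List A) (f : A → Carrier) → ∑ (xs ++ ys) f ≈ ∑ xs f + ∑ ys f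
  ∑-++ []       ys f = sym (+-identityˡ _)
  ∑-++ (x ∷ xs) ys f = trans (+-congˡ (∑-++ xs ys f)) (sym (+-assoc _ _ _))

  ∑-map : (xs : List A) (g : A → B) (f : B → Carrier) → ∑ (map g xs) f ≡ ∑ xs (f ∘ g)
  ∑-map []       g f = ≡.refl
  ∑-map (x ∷ xs) g f = ≡.cong (f (g x) +_) (∑-map xs g f)

  ∑-concatMap : (xs : List A) (g : A → List B) (f : B → Carrier) →
                ∑ (concatMap g xs) f ≈ ∑[ x ∈ xs ] ∑ (g x) f
  ∑-concatMap []       g f = refl
  ∑-concatMap (x ∷ xs) g f = trans (∑-++ (g x) _ f) (+-congˡ (∑-concatMap xs g f))

  ∑-distrib-+ : (xs : List A) (f g : A → Carrier) → ∑[ x ∈ xs ] (f x + g x) ≈ ∑ xs f + ∑ xs g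
  ∑-distrib-+ []       f g = sym (+-identityˡ _)
  ∑-distrib-+ (x ∷ xs) f g = trans (+-congˡ (∑-distrib-+ xs f g)) (interchange _ _ _ _)

  *-distribˡ-∑ : (xs : List A) (a : Carrier) (f : A → Carrier) → a * ∑ xs f ≈ ∑[ x ∈ xs ] (a * f x)
  *-distribˡ-∑ []       a f = zeroʳ a
  *-distribˡ-∑ (x ∷ xs) a f = trans (distribˡ a _ _) (+-congˡ (*-distribˡ-∑ xs a f))

  *-distribʳ-∑ : (xs : List A) (a : Carrier) (f : A → Carrier) → ∑ xs f * a ≈ ∑[ x ∈ xs ] (f x * a)
  *-distribʳ-∑ xs a f =
    trans (*-comm _ a) (trans (*-distribˡ-∑ xs a f) (∑-cong xs (λ x → *-comm a (f x))))

  -‿distrib-∑ : (xs : List A) (f : A → Carrier) → - ∑ xs f ≈ ∑[ x ∈ xs ] (- f x)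
  -‿distrib-∑ []       f = ε⁻¹≈ε
  -‿distrib-∑ (x ∷ xs) f = trans (sym (⁻¹-∙-comm _ _)) (+-congˡ (-‿distrib-∑ xs f))

  ∑-zero : (xs : List A) {f : A → Carrier} → (∀ x → f x ≈ 0#) → ∑ xs f ≈ 0#
  ∑-zero []       f≈0 = refl
  ∑-zero (x ∷ xs) f≈0 = trans (+-cong (f≈0 x) (∑-zero xs f≈0)) (+-identityˡ 0#)

  ∑-comm : (xs : List A) (ys : List B) (f : A → B → Carrier) →
           ∑[ x ∈ xs ] ∑ ys (f x) ≈ ∑[ y ∈ ys ] ∑[ x ∈ xs ] f x y
  ∑-comm []       ys f = sym (∑-zero ys (λ _ → refl))
  ∑-comm (x ∷ xs) ys f = trans (+-congˡ (∑-comm xs ys f)) (sym (∑-distrib-+ ys (f x) _))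

  ind : Bool → Carrier → Carrier
  ind true  x = x
  ind false x = 0#

  ind-T : ∀ {β} x → T β → ind β x ≡ x
  ind-T {true} x _ = ≡.refl

  ind-¬T : ∀ {β} x → ¬ T β → ind β x ≡ 0#
  ind-¬T {true}  x ¬β = ⊥-elim (¬β tt)
  ind-¬T {false} x ¬β = ≡.refl

  ind-∧ : ∀ β γ x → ind (β ∧ γ) x ≡ ind β (ind γ x)
  ind-∧ true  γ x = ≡.refl
  ind-∧ false γ x = ≡.refl

  ind-comm : ∀ β γ x → ind β (ind γ x) ≡ ind γ (ind β x)
  ind-comm true  γ     x = ≡.refl
  ind-comm false true  x = ≡.refl
  ind-comm false false x = ≡.refl

  ind-congᵀ : ∀ β {x y} → (T β → x ≈ y) → ind β x ≈ ind β y
  ind-congᵀ true  x≈y = x≈y tt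
  ind-congᵀ false x≈y = refl

  ind-cong : ∀ β {x y} → x ≈ y → ind β x ≈ ind β y
  ind-cong β = ind-congᵀ β ∘ const

  ind-zero : ∀ β {x} → (T β → x ≈ 0#) → ind β x ≈ 0#
  ind-zero true  x≈0 = x≈0 tt
  ind-zero false x≈0 = refl

  ind-elim : ∀ β {x} → (¬ T β → x ≈ 0#) → ind β x ≈ x
  ind-elim true  x≈0 = refl
  ind-elim false x≈0 = sym (x≈0 λ ())

  *-ind : ∀ β y x → y * ind β x ≈ ind β (y * x)
  *-ind true  y x = refl
  *-ind false y x = zeroʳ y

  ind-* : ∀ β y x → ind β x * y ≈ ind β (x * y)
  ind-* true  y x = refl
  ind-* false y x = zeroˡ y

  ind-+ : ∀ β x y → ind β (x + y) ≈ ind β x + ind β y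
  ind-+ true  x y = refl
  ind-+ false x y = sym (+-identityˡ 0#)

  ind-∑ : (β : Bool) (xs : List A) (f : A → Carrier) → ind β (∑ xs f) ≈ ∑[ x ∈ xs ] ind β (f x)
  ind-∑ true  xs f = refl
  ind-∑ false xs f = sym (∑-zero xs (λ _ → refl))

  ∑-ind-∧ : (β : Bool) (γ : A → Bool) (xs : List A) (f : A → Carrier) →
            ∑[ x ∈ xs ] ind (β ∧ γ x) (f x) ≈ ind β (∑[ x ∈ xs ] ind (γ x) (f x))
  ∑-ind-∧ β γ xs f =
    trans (∑-cong xs (λ x → reflexive (ind-∧ β (γ x) (f x)))) (sym (ind-∑ β xs _))

  ∑-filter : (xs : List A) (p : A → Bool) (f : A → Carrier) →
             ∑ (filter (λ x → p x Data.Bool.≟ true) xs) f ≈ ∑[ x ∈ xs ] ind (p x) (f x)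
  ∑-filter []       p f = refl
  ∑-filter (x ∷ xs) p f with p x
  ... | true  = +-congˡ (∑-filter xs p f)
  ... | false = trans (∑-filter xs p f) (sym (+-identityˡ _))

  ∑<-suc : ∀ n f → ∑< (suc n) f ≈ ∑< n f + f n
  ∑<-suc n f = begin
    ∑< (suc n) f          ≡⟨ ≡.cong (λ is → ∑ is f) (≡.sym (Listₚ.upTo-∷ʳ n)) ⟩
    ∑ (upTo n ++ n ∷ []) f ≈⟨ ∑-++ (upTo n) (n ∷ []) f ⟩
    ∑< n f + (f n + 0#)   ≈⟨ +-congˡ (+-identityʳ _) ⟩
    ∑< n f + f n          ∎

  ∑<-shift : ∀ n f → ∑< (suc n) f ≈ f 0 + ∑< n (f ∘ suc)
  ∑<-shift n f = +-congˡ (reflexive (≡.trans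
    (≡.cong (λ is → ∑ is f) (≡.sym (Listₚ.map-upTo suc n))) (∑-map (upTo n) suc f)))

  ∑<-cong : ∀ n {f g} → (∀ i → i < n → f i ≈ g i) → ∑< n f ≈ ∑< n g
  ∑<-cong zero    f≈g = refl
  ∑<-cong (suc n) {f} {g} f≈g = begin
    ∑< (suc n) f ≈⟨ ∑<-suc n f ⟩
    ∑< n f + f n ≈⟨ +-cong (∑<-cong n (λ i i<n → f≈g i (ℕₚ.m<n⇒m<1+n i<n))) (f≈g n ℕₚ.≤-refl) ⟩
    ∑< n g + g n ≈⟨ ∑<-suc n g ⟨
    ∑< (suc n) g ∎

  ∑<-zero : ∀ n {f} → (∀ i → i < n → f i ≈ 0#) → ∑< n f ≈ 0#
  ∑<-zero n f≈0 = trans (∑<-cong n f≈0) (∑-zero (upTo n) (λ _ → refl))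

  ∑<-truncate : ∀ {k n} f → k ≤ n → (∀ i → k ≤ i → i < n → f i ≈ 0#) → ∑< n f ≈ ∑< k f
  ∑<-truncate f k≤n = go (ℕₚ.≤⇒≤′ k≤n)
    where
    go : ∀ {k n} → k ≤′ n → (∀ i → k ≤ i → i < n → f i ≈ 0#) → ∑< n f ≈ ∑< k f
    go (≤′-reflexive ≡.refl) _ = refl
    go {k} (≤′-step {n} k≤′n) tail≈0 = begin
      ∑< (suc n) f ≈⟨ ∑<-suc n f ⟩
      ∑< n f + f n ≈⟨ +-cong (go k≤′n (λ i k≤i i<n → tail≈0 i k≤i (ℕₚ.m<n⇒m<1+n i<n)))
                             (tail≈0 n (ℕₚ.≤′⇒≤ k≤′n) ℕₚ.≤-refl) ⟩
      ∑< k f + 0#  ≈⟨ +-identityʳ _ ⟩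
      ∑< k f       ∎

  ∑<-single : ∀ {k n} f → k < n → (∀ i → i < n → i ≢ k → f i ≈ 0#) → ∑< n f ≈ f k
  ∑<-single {k} {n} f k<n others≈0 = begin
    ∑< n f           ≈⟨ ∑<-truncate f k<n (λ i k<i i<n → others≈0 i i<n (ℕₚ.>⇒≢ k<i)) ⟩
    ∑< (suc k) f     ≈⟨ ∑<-suc k f ⟩
    ∑< k f + f k     ≈⟨ +-congʳ (∑<-zero k λ i i<k → others≈0 i (ℕₚ.<-trans i<k k<n) (ℕₚ.<⇒≢ i<k)) ⟩
    0# + f k         ≈⟨ +-identityˡ _ ⟩
    f k              ∎

  ∑<-ind-< : ∀ {k n} f → k ≤ n → ∑[ i < n ] ind (i <ᵇ k) (f i) ≈ ∑< k f
  ∑<-ind-< {k} {n} f k≤n = begin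
    ∑[ i < n ] ind (i <ᵇ k) (f i) ≈⟨ ∑<-truncate _ k≤n (λ i k≤i _ →
                                       reflexive (ind-¬T (f i) (ℕₚ.≤⇒≯ k≤i ∘ ℕₚ.<ᵇ⇒< i k))) ⟩
    ∑[ i < k ] ind (i <ᵇ k) (f i) ≈⟨ ∑<-cong k (λ i i<k → reflexive (ind-T (f i) (ℕₚ.<⇒<ᵇ i<k))) ⟩
    ∑< k f                        ∎

  ∑<-ind-≤ : ∀ {k n} f → k < n → ∑[ i < n ] ind (i ≤ᵇ k) (f i) ≈ ∑< (suc k) f
  ∑<-ind-≤ {k} {n} f k<n = begin
    ∑[ i < n ] ind (i ≤ᵇ k) (f i)     ≈⟨ ∑<-cong n (λ i _ →
                                           reflexive (≡.cong (λ β → ind β (f i)) (≤ᵇ≡<ᵇ-suc i))) ⟩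
    ∑[ i < n ] ind (i <ᵇ suc k) (f i) ≈⟨ ∑<-ind-< f k<n ⟩
    ∑< (suc k) f                  ∎
    where
    ≤ᵇ≡<ᵇ-suc : ∀ i → (i ≤ᵇ k) ≡ (i <ᵇ suc k)
    ≤ᵇ≡<ᵇ-suc zero    = ≡.refl
    ≤ᵇ≡<ᵇ-suc (suc i) = ≡.refl

  ∑<-ind-offset : ∀ {j w n} (f : ℕ → Carrier) → j ℕ.+ w < n →
                  ∑[ i < n ] ind (j ≤ᵇ i) (ind (w ≡ᵇ i ∸ j) (f i)) ≈ f (j ℕ.+ w)
  ∑<-ind-offset {j} {w} {n} f j+w<n = trans (∑<-single _ j+w<n others≈0) on-offset
    where
    others≈0 : ∀ i → i < n → i ≢ j ℕ.+ w → ind (j ≤ᵇ i) (ind (w ≡ᵇ i ∸ j) (f i)) ≈ 0#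
    others≈0 i _ i≢j+w = ind-zero (j ≤ᵇ i) λ j≤i → ind-zero (w ≡ᵇ i ∸ j) λ w≡i∸j →
      ⊥-elim (i≢j+w (≡.trans (≡.sym (ℕₚ.m+[n∸m]≡n (ℕₚ.≤ᵇ⇒≤ j i j≤i)))
                             (≡.cong (j ℕ.+_) (≡.sym (ℕₚ.≡ᵇ⇒≡ w (i ∸ j) w≡i∸j)))))
    on-offset : ind (j ≤ᵇ j ℕ.+ w) (ind (w ≡ᵇ j ℕ.+ w ∸ j) (f (j ℕ.+ w))) ≈ f (j ℕ.+ w)
    on-offset = reflexive (≡.trans (ind-T _ (ℕₚ.≤⇒≤ᵇ (ℕₚ.m≤m+n j w)))
                                   (ind-T _ (ℕₚ.≡⇒≡ᵇ w (j ℕ.+ w ∸ j) (≡.sym (ℕₚ.m+n∸m≡n j w)))))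

module ChainSums {c ℓr : Level} (R : CommutativeRing c ℓr) (φ : ℕ → ℕ → CommutativeRing.Carrier R) where
  open CommutativeRing R hiding (zero)
  open Sums R
  open import Relation.Binary.Reasoning.Setoid setoid

  -- chainSum n M a sums φ s₁ t₁ ⋯ φ sₙ tₙ over all a ≤ s₁ < t₁ ≤ s₂ < t₂ ≤ ⋯ ≤ sₙ < tₙ ≤ M.
  chainSum : ℕ → ℕ → ℕ → Carrier
  chainSum zero    M a = 1#
  chainSum (suc n) M a = ∑[ t < suc M ] ∑[ s < t ] ind (a ≤ᵇ s) (φ s t * chainSum n M t)

  -- The same sum restricted to chains of n + 1 pairs whose last pair ends at e.
  chainSumEndingAt : ℕ → ℕ → ℕ → Carrier
  chainSumEndingAt n e a = ∑[ k < e ] ind (a ≤ᵇ k) (chainSum n k a * φ k e)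

  chainSum-vanishes : ∀ n {M a} → M ≤ a ℕ.+ n → chainSum (suc n) M a ≈ 0#
  chainSum-vanishes n {M} {a} M≤a+n =
    ∑<-zero (suc M) λ t t≤M → ∑<-zero t λ s s<t →
      ind-zero (a ≤ᵇ s) λ a≤s → term n M≤a+n (ℕₚ.≤ᵇ⇒≤ a s a≤s) s<t (ℕₚ.≤-pred t≤M)
    where
    term : ∀ n {s t} → M ≤ a ℕ.+ n → a ≤ s → s < t → t ≤ M → φ s t * chainSum n M t ≈ 0#
    term zero    M≤a+0 a≤s s<t t≤M =
      ⊥-elim (ℕₚ.<-irrefl ≡.refl (ℕₚ.<-≤-trans (ℕₚ.<-≤-trans (ℕₚ.≤-<-trans a≤s s<t) t≤M)
                                               (ℕₚ.≤-trans M≤a+0 (ℕₚ.≤-reflexive (ℕₚ.+-identityʳ a)))))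
    term (suc n) {s} {t} M≤a+n a≤s s<t t≤M =
      trans (*-congˡ (chainSum-vanishes n (ℕₚ.≤-trans M≤a+n a+1+n≤t+n))) (zeroʳ _)
      where
      a+1+n≤t+n : a ℕ.+ suc n ≤ t ℕ.+ n
      a+1+n≤t+n = ℕₚ.≤-trans (ℕₚ.≤-reflexive (ℕₚ.+-suc a n)) (ℕₚ.+-monoˡ-≤ n (ℕₚ.≤-<-trans a≤s s<t))

  chainSum-long : ∀ {n M} a → suc (suc M) ≤ n → chainSum n M a ≈ 0#
  chainSum-long {suc n} {M} a (s≤s M+1≤n) =
    chainSum-vanishes n (ℕₚ.≤-trans (ℕₚ.n≤1+n M) (ℕₚ.≤-trans M+1≤n (ℕₚ.m≤n+m n a)))

  chainSum-beyond : ∀ n {k a} → k < a → chainSum (suc n) k a ≈ 0#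
  chainSum-beyond n {k} {a} k<a = chainSum-vanishes n (ℕₚ.≤-trans (ℕₚ.<⇒≤ k<a) (ℕₚ.m≤m+n a n))

  chainSumEndingAt-suc : ∀ n e a →
    ∑[ t < e ] ∑[ s < t ] ind (a ≤ᵇ s) (φ s t * chainSumEndingAt n e t) ≈ chainSumEndingAt (suc n) e a
  chainSumEndingAt-suc n e a = begin
    ∑[ t < e ] ∑[ s < t ] ind (a ≤ᵇ s) (φ s t * chainSumEndingAt n e t)
      ≈⟨ ∑-cong (upTo e) (λ t → ∑-cong (upTo t) (expand t)) ⟩
    ∑[ t < e ] ∑[ s < t ] ∑[ k < e ] G t s k
      ≈⟨ ∑-cong (upTo e) (λ t → ∑-comm (upTo t) (upTo e) (G t)) ⟩
    ∑[ t < e ] ∑[ k < e ] ∑[ s < t ] G t s k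
      ≈⟨ ∑-comm (upTo e) (upTo e) _ ⟩
    ∑[ k < e ] ∑[ t < e ] ∑[ s < t ] G t s k
      ≈⟨ ∑<-cong e collapse ⟩
    chainSumEndingAt (suc n) e a ∎
    where
    G : ℕ → ℕ → ℕ → Carrier
    G t s k = ind (t ≤ᵇ k) (ind (a ≤ᵇ s) (φ s t * chainSum n k t * φ k e))

    reorder : ∀ t s k → ind (a ≤ᵇ s) (φ s t * ind (t ≤ᵇ k) (chainSum n k t * φ k e)) ≈ G t s k
    reorder t s k = begin
      ind (a ≤ᵇ s) (φ s t * ind (t ≤ᵇ k) (chainSum n k t * φ k e))
        ≈⟨ ind-cong (a ≤ᵇ s) (*-ind (t ≤ᵇ k) _ _) ⟩
      ind (a ≤ᵇ s) (ind (t ≤ᵇ k) (φ s t * (chainSum n k t * φ k e)))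
        ≡⟨ ind-comm (a ≤ᵇ s) (t ≤ᵇ k) _ ⟩
      ind (t ≤ᵇ k) (ind (a ≤ᵇ s) (φ s t * (chainSum n k t * φ k e)))
        ≈⟨ ind-cong (t ≤ᵇ k) (ind-cong (a ≤ᵇ s) (sym (*-assoc _ _ _))) ⟩
      G t s k ∎

    expand : ∀ t s → ind (a ≤ᵇ s) (φ s t * chainSumEndingAt n e t) ≈ ∑[ k < e ] G t s k
    expand t s = begin
      ind (a ≤ᵇ s) (φ s t * chainSumEndingAt n e t)
        ≈⟨ ind-cong (a ≤ᵇ s) (*-distribˡ-∑ (upTo e) (φ s t) _) ⟩
      ind (a ≤ᵇ s) (∑[ k < e ] φ s t * ind (t ≤ᵇ k) (chainSum n k t * φ k e))
        ≈⟨ ind-∑ (a ≤ᵇ s) (upTo e) _ ⟩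
      ∑[ k < e ] ind (a ≤ᵇ s) (φ s t * ind (t ≤ᵇ k) (chainSum n k t * φ k e))
        ≈⟨ ∑-cong (upTo e) (reorder t s) ⟩
      ∑[ k < e ] G t s k ∎

    collapse : ∀ k → k < e → ∑[ t < e ] ∑[ s < t ] G t s k ≈ ind (a ≤ᵇ k) (chainSum (suc n) k a * φ k e)
    collapse k k<e = begin
      ∑[ t < e ] ∑[ s < t ] G t s k
        ≈⟨ ∑-cong (upTo e) (λ t → ind-∑ (t ≤ᵇ k) (upTo t) _) ⟨
      ∑[ t < e ] ind (t ≤ᵇ k) (∑[ s < t ] ind (a ≤ᵇ s) (φ s t * chainSum n k t * φ k e))
        ≈⟨ ∑<-ind-≤ _ k<e ⟩
      ∑[ t < suc k ] ∑[ s < t ] ind (a ≤ᵇ s) (φ s t * chainSum n k t * φ k e)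
        ≈⟨ ∑-cong (upTo (suc k)) (λ t → trans (*-distribʳ-∑ (upTo t) _ _)
                                                (∑-cong (upTo t) (λ s → ind-* (a ≤ᵇ s) _ _))) ⟨
      ∑[ t < suc k ] (∑[ s < t ] ind (a ≤ᵇ s) (φ s t * chainSum n k t)) * φ k e
        ≈⟨ *-distribʳ-∑ (upTo (suc k)) _ _ ⟨
      chainSum (suc n) k a * φ k e
        ≈⟨ ind-elim (a ≤ᵇ k) (λ a≰k →
             trans (*-congʳ (chainSum-beyond n {k} {a} (ℕₚ.≰⇒> (a≰k ∘ ℕₚ.≤⇒≤ᵇ))))
                                             (zeroˡ _)) ⟨
      ind (a ≤ᵇ k) (chainSum (suc n) k a * φ k e) ∎

  -- A chain either stays within [a, M] or its last pair ends at M + 1.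
  chainSum-extend : ∀ n M a →
    chainSum (suc n) (suc M) a ≈ chainSum (suc n) M a + chainSumEndingAt n (suc M) a
  chainSum-extend zero M a = begin
    chainSum 1 (suc M) a
      ≈⟨ ∑<-suc (suc M) _ ⟩
    chainSum 1 M a + (∑[ s < suc M ] ind (a ≤ᵇ s) (φ s (suc M) * 1#))
      ≈⟨ +-congˡ (∑-cong (upTo (suc M)) (λ s → ind-cong (a ≤ᵇ s) (*-comm _ _))) ⟩
    chainSum 1 M a + chainSumEndingAt 0 (suc M) a ∎
  chainSum-extend (suc n) M a = begin
    chainSum (suc (suc n)) (suc M) a
      ≈⟨ ∑<-suc (suc M) _ ⟩
    (∑[ t < suc M ] ∑[ s < t ] ind (a ≤ᵇ s) (φ s t * chainSum (suc n) (suc M) t)) + lastPair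
      ≈⟨ +-cong (∑-cong (upTo (suc M)) (λ t → ∑-cong (upTo t) (λ s →
                  ind-cong (a ≤ᵇ s) (*-congˡ (chainSum-extend n M t)))))
                lastPair≈0 ⟩
    (∑[ t < suc M ] ∑[ s < t ] ind (a ≤ᵇ s) (φ s t * (chainSum (suc n) M t + E t))) + 0#
      ≈⟨ +-identityʳ _ ⟩
    ∑[ t < suc M ] ∑[ s < t ] ind (a ≤ᵇ s) (φ s t * (chainSum (suc n) M t + E t))
      ≈⟨ ∑-cong (upTo (suc M)) split ⟩
    ∑[ t < suc M ] ((∑[ s < t ] ind (a ≤ᵇ s) (φ s t * chainSum (suc n) M t))
                     + (∑[ s < t ] ind (a ≤ᵇ s) (φ s t * E t)))
      ≈⟨ ∑-distrib-+ (upTo (suc M)) _ _ ⟩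
    chainSum (suc (suc n)) M a + (∑[ t < suc M ] ∑[ s < t ] ind (a ≤ᵇ s) (φ s t * E t))
      ≈⟨ +-congˡ (chainSumEndingAt-suc n (suc M) a) ⟩
    chainSum (suc (suc n)) M a + chainSumEndingAt (suc n) (suc M) a ∎
    where
    E : ℕ → Carrier
    E = chainSumEndingAt n (suc M)

    lastPair : Carrier
    lastPair = ∑[ s < suc M ] ind (a ≤ᵇ s) (φ s (suc M) * chainSum (suc n) (suc M) (suc M))

    lastPair≈0 : lastPair ≈ 0#
    lastPair≈0 = ∑<-zero (suc M) λ s _ → ind-zero (a ≤ᵇ s) λ _ →
      trans (*-congˡ (chainSum-vanishes n (ℕₚ.m≤m+n (suc M) n))) (zeroʳ _)

    split : ∀ t → ∑[ s < t ] ind (a ≤ᵇ s) (φ s t * (chainSum (suc n) M t + E t))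
                ≈ (∑[ s < t ] ind (a ≤ᵇ s) (φ s t * chainSum (suc n) M t))
                  + (∑[ s < t ] ind (a ≤ᵇ s) (φ s t * E t))
    split t = trans (∑-cong (upTo t) (λ s → trans (ind-cong (a ≤ᵇ s) (distribˡ _ _ _)) (ind-+ (a ≤ᵇ s) _ _)))
                    (∑-distrib-+ (upTo t) _ _)

  -- A chain from a to M has at most M + 1 pairs.
  totalChainSum : ℕ → ℕ → Carrier
  totalChainSum M a = ∑[ n < suc (suc M) ] chainSum n M a

  ∑<-chainSum : ∀ {N M} a → suc (suc M) ≤ N → ∑[ n < N ] chainSum n M a ≈ totalChainSum M a
  ∑<-chainSum a 2+M≤N = ∑<-truncate _ 2+M≤N (λ n 2+M≤n _ → chainSum-long a 2+M≤n)

  totalChainSum-diag : ∀ M → totalChainSum M M ≈ 1#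
  totalChainSum-diag M = begin
    totalChainSum M M                                  ≈⟨ ∑<-shift (suc M) _ ⟩
    1# + (∑[ n < suc M ] chainSum (suc n) M M)         ≈⟨ +-congˡ (∑<-zero (suc M) λ n _ →
                                                             chainSum-vanishes n (ℕₚ.m≤m+n M n)) ⟩
    1# + 0#                                            ≈⟨ +-identityʳ 1# ⟩
    1#                                                 ∎

  totalChainSum-extend : ∀ M j → totalChainSum (suc M) j
    ≈ totalChainSum M j + (∑[ k < suc M ] ind (j ≤ᵇ k) (totalChainSum k j * φ k (suc M)))
  totalChainSum-extend M j = begin
    totalChainSum (suc M) j
      ≈⟨ ∑<-shift bound _ ⟩
    1# + (∑[ n < bound ] chainSum (suc n) (suc M) j)
      ≈⟨ +-congˡ (trans (∑-cong (upTo bound) (λ n → chainSum-extend n M j))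
                        (∑-distrib-+ (upTo bound) (λ n → chainSum (suc n) M j) endingAt)) ⟩
    1# + ((∑[ n < bound ] chainSum (suc n) M j) + ∑< bound endingAt)
      ≈⟨ +-assoc _ _ _ ⟨
    (1# + (∑[ n < bound ] chainSum (suc n) M j)) + ∑< bound endingAt
      ≈⟨ +-congʳ (∑<-shift bound (λ n → chainSum n M j)) ⟨
    (∑[ n < suc bound ] chainSum n M j) + ∑< bound endingAt
      ≈⟨ +-cong (∑<-chainSum {suc bound} j (ℕₚ.n≤1+n bound)) endings ⟩
    totalChainSum M j + (∑[ k < suc M ] ind (j ≤ᵇ k) (totalChainSum k j * φ k (suc M))) ∎
    where
    bound : ℕ
    bound = suc (suc M)

    endingAt : ℕ → Carrier
    endingAt n = chainSumEndingAt n (suc M) j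

    term : ℕ → ℕ → Carrier
    term n k = chainSum n k j * φ k (suc M)

    endings : ∑< bound endingAt ≈ ∑[ k < suc M ] ind (j ≤ᵇ k) (totalChainSum k j * φ k (suc M))
    endings = trans (∑-comm (upTo bound) (upTo (suc M)) λ n k → ind (j ≤ᵇ k) (term n k))
                    (∑<-cong (suc M) λ k k≤M → begin
      ∑[ n < bound ] ind (j ≤ᵇ k) (term n k)
        ≈⟨ ind-∑ (j ≤ᵇ k) (upTo bound) (λ n → term n k) ⟨
      ind (j ≤ᵇ k) (∑[ n < bound ] term n k)
        ≈⟨ ind-cong (j ≤ᵇ k) (*-distribʳ-∑ (upTo bound) (φ k (suc M)) (λ n → chainSum n k j)) ⟨
      ind (j ≤ᵇ k) ((∑[ n < bound ] chainSum n k j) * φ k (suc M))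
        ≈⟨ ind-cong (j ≤ᵇ k) (*-congʳ (∑<-chainSum j (s≤s k≤M))) ⟩
      ind (j ≤ᵇ k) (totalChainSum k j * φ k (suc M)) ∎)

module Recurrence {c ℓr : Level} (R : CommutativeRing c ℓr) (φ : ℕ → ℕ → CommutativeRing.Carrier R)
                  (coef : ℕ → CommutativeRing.Carrier R) where
  open CommutativeRing R hiding (zero)
  open Sums R
  open ChainSums R φ
  open import Relation.Binary.Reasoning.Setoid setoid
  open import Algebra.Properties.CommutativeSemigroup +-commutativeSemigroup using (xy∙z≈xz∙y)
  open import Algebra.Properties.CommutativeSemigroup *-commutativeSemigroup using (x∙yz≈z∙xy)

  solution : ℕ → Carrier
  solution M = ∑[ j < suc M ] coef j * totalChainSum M j

  solution-zero : solution 0 ≈ coef 0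
  solution-zero = trans (+-identityʳ _) (trans (*-congˡ (totalChainSum-diag 0)) (*-identityʳ _))

  solution-suc : ∀ M → solution (suc M)
    ≈ (solution M + coef (suc M)) + (∑[ k < suc M ] φ k (suc M) * solution k)
  solution-suc M = begin
    solution (suc M)
      ≈⟨ ∑<-suc (suc M) _ ⟩
    (∑[ j < suc M ] coef j * totalChainSum (suc M) j) + coef (suc M) * totalChainSum (suc M) (suc M)
      ≈⟨ +-cong (∑-cong (upTo (suc M)) λ j → trans (*-congˡ (totalChainSum-extend M j)) (distribˡ _ _ _))
                (trans (*-congˡ (totalChainSum-diag (suc M))) (*-identityʳ _)) ⟩
    (∑[ j < suc M ] (coef j * totalChainSum M j + coef j * W j)) + coef (suc M)
      ≈⟨ +-congʳ (∑-distrib-+ (upTo (suc M)) _ _) ⟩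
    (solution M + (∑[ j < suc M ] coef j * W j)) + coef (suc M)
      ≈⟨ xy∙z≈xz∙y _ _ _ ⟩
    (solution M + coef (suc M)) + (∑[ j < suc M ] coef j * W j)
      ≈⟨ +-congˡ lastPairs ⟩
    (solution M + coef (suc M)) + (∑[ k < suc M ] φ k (suc M) * solution k) ∎
    where
    W : ℕ → Carrier
    W j = ∑[ k < suc M ] ind (j ≤ᵇ k) (totalChainSum k j * φ k (suc M))

    term : ℕ → ℕ → Carrier
    term j k = coef j * (totalChainSum k j * φ k (suc M))

    lastPairs : ∑[ j < suc M ] coef j * W j ≈ ∑[ k < suc M ] φ k (suc M) * solution k
    lastPairs = begin
      ∑[ j < suc M ] coef j * W j
        ≈⟨ ∑-cong (upTo (suc M)) (λ j → trans (*-distribˡ-∑ (upTo (suc M)) _ _)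
                                              (∑-cong (upTo (suc M)) λ k → *-ind (j ≤ᵇ k) _ _)) ⟩
      ∑[ j < suc M ] ∑[ k < suc M ] ind (j ≤ᵇ k) (term j k)
        ≈⟨ ∑-comm (upTo (suc M)) (upTo (suc M)) (λ j k → ind (j ≤ᵇ k) (term j k)) ⟩
      ∑[ k < suc M ] ∑[ j < suc M ] ind (j ≤ᵇ k) (term j k)
        ≈⟨ ∑<-cong (suc M) (λ k k≤M → ∑<-ind-≤ (λ j → term j k) k≤M) ⟩
      ∑[ k < suc M ] ∑[ j < suc k ] term j k
        ≈⟨ ∑-cong (upTo (suc M)) (λ k → trans (∑-cong (upTo (suc k)) λ j → x∙yz≈z∙xy _ _ _)
                                              (sym (*-distribˡ-∑ (upTo (suc k)) _ _))) ⟩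
      ∑[ k < suc M ] φ k (suc M) * solution k ∎

  solution-unique : ∀ (u : ℕ → Carrier) D → u 0 ≈ coef 0 →
    (∀ M → M < D → u (suc M) ≈ (u M + coef (suc M)) + (∑[ k < suc M ] φ k (suc M) * u k)) →
    ∀ M → M ≤ D → u M ≈ solution M
  solution-unique u D u₀ u-rec M M≤D = agreeUpTo M M≤D M ℕₚ.≤-refl
    where
    agreeUpTo : ∀ M → M ≤ D → ∀ k → k ≤ M → u k ≈ solution k
    agreeUpTo zero    _     zero    _ = trans u₀ (sym solution-zero)
    agreeUpTo (suc M) 1+M≤D k k≤1+M with ℕₚ.m≤n⇒m<n∨m≡n k≤1+M
    ... | inj₁ k<1+M  = agreeUpTo M (ℕₚ.≤-trans (ℕₚ.n≤1+n M) 1+M≤D) k (ℕₚ.≤-pred k<1+M)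
    ... | inj₂ ≡.refl = begin
      u (suc M)
        ≈⟨ u-rec M 1+M≤D ⟩
      (u M + coef (suc M)) + (∑[ k < suc M ] φ k (suc M) * u k)
        ≈⟨ +-cong (+-congʳ (ih M ℕₚ.≤-refl))
                  (∑<-cong (suc M) λ k k≤M → *-congˡ (ih k (ℕₚ.≤-pred k≤M))) ⟩
      (solution M + coef (suc M)) + (∑[ k < suc M ] φ k (suc M) * solution k)
        ≈⟨ solution-suc M ⟨
      solution (suc M) ∎
      where
      ih : ∀ k → k ≤ M → u k ≈ solution k
      ih = agreeUpTo M (ℕₚ.≤-trans (ℕₚ.n≤1+n M) 1+M≤D)

chainᵇ-∷⁻ : ∀ {a M s t} ps → T (chainᵇ a M ((s , t) ∷ ps)) → a ≤ s × s < t × t ≤ M × T (chainᵇ t M ps)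
chainᵇ-∷⁻ {a} {M} {s} {t} ps chain with Equivalence.to (T-∧ {a ≤ᵇ s}) chain
... | a≤s , chain′ with Equivalence.to (T-∧ {s <ᵇ t}) chain′
... | s<t , chain″ with Equivalence.to (T-∧ {t ≤ᵇ M}) chain″
... | t≤M , rest = ℕₚ.≤ᵇ⇒≤ a s a≤s , ℕₚ.<ᵇ⇒< s t s<t , ℕₚ.≤ᵇ⇒≤ t M t≤M , rest

chainᵇ-weight : ∀ {a M} ps → a ≤ M → T (chainᵇ a M ps) → a ℕ.+ weight ps ≤ M
chainᵇ-weight {a} {M} []             a≤M _     = ℕₚ.≤-trans (ℕₚ.≤-reflexive (ℕₚ.+-identityʳ a)) a≤M
chainᵇ-weight {a} {M} ((s , t) ∷ ps) _   chain with chainᵇ-∷⁻ ps chain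
... | a≤s , s<t , t≤M , rest = begin
  a ℕ.+ (t ∸ s ℕ.+ weight ps) ≡⟨ ℕₚ.+-assoc a (t ∸ s) (weight ps) ⟨
  a ℕ.+ (t ∸ s) ℕ.+ weight ps ≤⟨ ℕₚ.+-monoˡ-≤ (weight ps) (ℕₚ.+-monoˡ-≤ (t ∸ s) a≤s) ⟩
  s ℕ.+ (t ∸ s) ℕ.+ weight ps ≡⟨ ≡.cong (ℕ._+ weight ps) (ℕₚ.m+[n∸m]≡n (ℕₚ.<⇒≤ s<t)) ⟩
  t ℕ.+ weight ps             ≤⟨ chainᵇ-weight ps t≤M rest ⟩
  M                           ∎
  where open ℕₚ.≤-Reasoning

module ClosedForm {c ℓr : Level} (R : CommutativeRing c ℓr) (ℓ : ℕ → ℕ) (z : CommutativeRing.Carrier R) where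
  open CommutativeRing R hiding (zero)
  open RingDefs R
  open Sums R
  open import Relation.Binary.Reasoning.Setoid setoid
  open import Algebra.Properties.Ring ring using (-‿distribˡ-*)
  open import Algebra.Properties.CommutativeSemigroup *-commutativeSemigroup
    using (interchange; x∙yz≈y∙xz; xy∙z≈y∙xz)

  φ : ℕ → ℕ → Carrier
  φ s t = - (intR (b ℓ t s) * powR z (t ∸ s))

  open ChainSums R φ

  powR-+ : ∀ y p q → powR y (p ℕ.+ q) ≈ powR y p * powR y q
  powR-+ y zero    q = sym (*-identityˡ _)
  powR-+ y (suc p) q = trans (*-congˡ (powR-+ y p q)) (sym (*-assoc _ _ _))

  bPair : ℕ × ℕ → Carrier
  bPair (s , t) = intR (b ℓ t s)

  signedTerm : ℕ → List (ℕ × ℕ) → Carrier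
  signedTerm n ps = sgnR n * prodR (map bPair ps)

  signedTerm-∷ : ∀ n s t ps →
    signedTerm (suc n) ((s , t) ∷ ps) * powR z (weight ((s , t) ∷ ps)) ≈ φ s t * (signedTerm n ps * powR z (weight ps))
  signedTerm-∷ n s t ps = begin
    - u * (β * π) * powR z (t ∸ s ℕ.+ weight ps) ≈⟨ *-congˡ (powR-+ z (t ∸ s) (weight ps)) ⟩
    - u * (β * π) * (ζ * ζ′)                     ≈⟨ *-congʳ (-‿distribˡ-* u (β * π)) ⟨
    - (u * (β * π)) * (ζ * ζ′)                   ≈⟨ -‿distribˡ-* _ _ ⟨
    - (u * (β * π) * (ζ * ζ′))                   ≈⟨ -‿cong (*-congʳ (x∙yz≈y∙xz u β π)) ⟩
    - (β * (u * π) * (ζ * ζ′))                   ≈⟨ -‿cong (interchange β (u * π) ζ ζ′) ⟩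
    - (β * ζ * (u * π * ζ′))                     ≈⟨ -‿distribˡ-* _ _ ⟩
    - (β * ζ) * (u * π * ζ′)                     ∎
    where
    u β π ζ ζ′ : Carrier
    u = sgnR n
    β = intR (b ℓ t s)
    π = prodR (map bPair ps)
    ζ = powR z (t ∸ s)
    ζ′ = powR z (weight ps)

  ∑-pairsUpTo : ∀ M (g : ℕ × ℕ → Carrier) → ∑ (pairsUpTo M) g ≈ ∑[ s < suc M ] ∑[ t < suc M ] g (s , t)
  ∑-pairsUpTo M g = trans (∑-concatMap (upTo (suc M)) (λ s → map (s ,_) (upTo (suc M))) g)
                          (∑-cong (upTo (suc M)) λ s → reflexive (∑-map (upTo (suc M)) (s ,_) g))

  chainTerm : ℕ → ℕ → ℕ → List (ℕ × ℕ) → Carrier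
  chainTerm n M a ps = ind (chainᵇ a M ps) (signedTerm n ps * powR z (weight ps))

  ∑-chainTerm : ∀ n M a → ∑ (listsOf n (pairsUpTo M)) (chainTerm n M a) ≈ chainSum n M a
  ∑-chainTerm zero    M a = trans (+-identityʳ _) (trans (*-identityʳ _) (*-identityʳ _))
  ∑-chainTerm (suc n) M a = begin
    ∑ (concatMap (λ q → map (q ∷_) L) (pairsUpTo M)) (chainTerm (suc n) M a)
      ≈⟨ ∑-concatMap (pairsUpTo M) (λ q → map (q ∷_) L) (chainTerm (suc n) M a) ⟩
    ∑[ q ∈ pairsUpTo M ] ∑ (map (q ∷_) L) (chainTerm (suc n) M a)
      ≈⟨ ∑-cong (pairsUpTo M) (λ q → reflexive (∑-map L (q ∷_) _)) ⟩
    ∑[ q ∈ pairsUpTo M ] ∑[ ps ∈ L ] chainTerm (suc n) M a (q ∷ ps)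
      ≈⟨ ∑-pairsUpTo M (λ q → ∑[ ps ∈ L ] chainTerm (suc n) M a (q ∷ ps)) ⟩
    ∑[ s < suc M ] ∑[ t < suc M ] ∑[ ps ∈ L ] chainTerm (suc n) M a ((s , t) ∷ ps)
      ≈⟨ ∑-cong (upTo (suc M)) (λ s → ∑<-cong (suc M) (firstPair s)) ⟩
    ∑[ s < suc M ] ∑[ t < suc M ] ind (s <ᵇ t) (ind (a ≤ᵇ s) (φ s t * chainSum n M t))
      ≈⟨ ∑-comm (upTo (suc M)) (upTo (suc M)) _ ⟩
    ∑[ t < suc M ] ∑[ s < suc M ] ind (s <ᵇ t) (ind (a ≤ᵇ s) (φ s t * chainSum n M t))
      ≈⟨ ∑<-cong (suc M) (λ t t≤M → ∑<-ind-< _ (ℕₚ.<⇒≤ t≤M)) ⟩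
    chainSum (suc n) M a ∎
    where
    L : List (List (ℕ × ℕ))
    L = listsOf n (pairsUpTo M)

    firstPair : ∀ s t → t < suc M →
      ∑[ ps ∈ L ] chainTerm (suc n) M a ((s , t) ∷ ps) ≈ ind (s <ᵇ t) (ind (a ≤ᵇ s) (φ s t * chainSum n M t))
    firstPair s t t≤M = begin
      ∑[ ps ∈ L ] chainTerm (suc n) M a ((s , t) ∷ ps)
        ≈⟨ ∑-ind-∧ (a ≤ᵇ s) _ L _ ⟩
      ind (a ≤ᵇ s) (∑[ ps ∈ L ] ind ((s <ᵇ t) ∧ (t ≤ᵇ M) ∧ chainᵇ t M ps)
                                    (signedTerm (suc n) ((s , t) ∷ ps) * powR z (weight ((s , t) ∷ ps))))
        ≈⟨ ind-cong (a ≤ᵇ s) (trans (∑-ind-∧ (s <ᵇ t) _ L _)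
                                    (ind-cong (s <ᵇ t) (∑-ind-∧ (t ≤ᵇ M) _ L _))) ⟩
      ind (a ≤ᵇ s) (ind (s <ᵇ t) (ind (t ≤ᵇ M)
        (∑[ ps ∈ L ] ind (chainᵇ t M ps) (signedTerm (suc n) ((s , t) ∷ ps) * powR z (weight ((s , t) ∷ ps))))))
        ≡⟨ ≡.cong (λ x → ind (a ≤ᵇ s) (ind (s <ᵇ t) x)) (ind-T _ (ℕₚ.≤⇒≤ᵇ (ℕₚ.≤-pred t≤M))) ⟩
      ind (a ≤ᵇ s) (ind (s <ᵇ t)
        (∑[ ps ∈ L ] ind (chainᵇ t M ps) (signedTerm (suc n) ((s , t) ∷ ps) * powR z (weight ((s , t) ∷ ps)))))
        ≈⟨ ind-cong (a ≤ᵇ s) (ind-cong (s <ᵇ t) (∑-cong L λ ps →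
             trans (ind-cong (chainᵇ t M ps) (signedTerm-∷ n s t ps)) (sym (*-ind (chainᵇ t M ps) _ _)))) ⟩
      ind (a ≤ᵇ s) (ind (s <ᵇ t) (∑[ ps ∈ L ] φ s t * chainTerm n M t ps))
        ≈⟨ ind-cong (a ≤ᵇ s) (ind-cong (s <ᵇ t) (trans (sym (*-distribˡ-∑ L (φ s t) _))
                                                       (*-congˡ (∑-chainTerm n M t)))) ⟩
      ind (a ≤ᵇ s) (ind (s <ᵇ t) (φ s t * chainSum n M t))
        ≡⟨ ind-comm (a ≤ᵇ s) (s <ᵇ t) _ ⟩
      ind (s <ᵇ t) (ind (a ≤ᵇ s) (φ s t * chainSum n M t)) ∎

  coeff-as-∑ : ∀ M i j → coeff ℓ (suc M) i j
    ≈ ∑[ n < suc (suc M) ] ∑[ ps ∈ listsOf n (pairsUpTo M) ]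
        ind (chainᵇ j M ps) (ind (weight ps ≡ᵇ i ∸ j) (signedTerm n ps))
  coeff-as-∑ M i j = ∑-cong (upTo (suc (suc M))) λ n →
    trans (∑-filter (listsOf n (pairsUpTo M)) (λ ps → chainᵇ j M ps ∧ (weight ps ≡ᵇ i ∸ j)) _)
          (∑-cong (listsOf n (pairsUpTo M)) λ ps → reflexive (≡.trans (ind-∧ (chainᵇ j M ps) _ _)
            (≡.cong (λ bs → ind (chainᵇ j M ps) (ind (weight ps ≡ᵇ i ∸ j) (sgnR n * prodR bs)))
                    (Listₚ.map-cong (λ { (s , t) → ≡.refl }) ps))))

  ∑-powers-chainTerm : ∀ {M j} n ps → j ≤ M →
    ∑[ i < suc M ] ind (j ≤ᵇ i) (ind (chainᵇ j M ps) (ind (weight ps ≡ᵇ i ∸ j) (signedTerm n ps * powR z i)))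
      ≈ powR z j * chainTerm n M j ps
  ∑-powers-chainTerm {M} {j} n ps j≤M = begin
    ∑[ i < suc M ] ind (j ≤ᵇ i) (ind chain (ind (weight ps ≡ᵇ i ∸ j) (V * powR z i)))
      ≈⟨ ∑-cong (upTo (suc M)) (λ i → reflexive (ind-comm (j ≤ᵇ i) chain _)) ⟩
    ∑[ i < suc M ] ind chain (ind (j ≤ᵇ i) (ind (weight ps ≡ᵇ i ∸ j) (V * powR z i)))
      ≈⟨ ind-∑ chain (upTo (suc M)) _ ⟨
    ind chain (∑[ i < suc M ] ind (j ≤ᵇ i) (ind (weight ps ≡ᵇ i ∸ j) (V * powR z i)))
      ≈⟨ ind-congᵀ chain (λ h → ∑<-ind-offset {j} {weight ps} (λ i → V * powR z i)
                                                (s≤s (chainᵇ-weight ps j≤M h))) ⟩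
    ind chain (V * powR z (j ℕ.+ weight ps))
      ≈⟨ ind-cong chain (trans (*-congˡ (powR-+ z j (weight ps))) (x∙yz≈y∙xz _ _ _)) ⟩
    ind chain (powR z j * (V * powR z (weight ps)))
      ≈⟨ *-ind chain _ _ ⟨
    powR z j * chainTerm n M j ps ∎
    where
    chain : Bool
    chain = chainᵇ j M ps
    V : Carrier
    V = signedTerm n ps

  ∑-coeff-powers : ∀ M j → j ≤ M →
    ∑[ i < suc M ] ind (j ≤ᵇ i) (coeff ℓ (suc M) i j * powR z i) ≈ powR z j * totalChainSum M j
  ∑-coeff-powers M j j≤M = begin
    ∑[ i < suc M ] ind (j ≤ᵇ i) (coeff ℓ (suc M) i j * powR z i)
      ≈⟨ ∑-cong (upTo (suc M)) (λ i → trans (ind-cong (j ≤ᵇ i) (expand i))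
                                      (trans (ind-∑ (j ≤ᵇ i) (upTo #n) _)
                                             (∑-cong (upTo #n) λ n → ind-∑ (j ≤ᵇ i) (L n) _))) ⟩
    ∑[ i < suc M ] ∑[ n < #n ] ∑[ ps ∈ L n ] ind (j ≤ᵇ i) (term i n ps)
      ≈⟨ ∑-comm (upTo (suc M)) (upTo #n) _ ⟩
    ∑[ n < #n ] ∑[ i < suc M ] ∑[ ps ∈ L n ] ind (j ≤ᵇ i) (term i n ps)
      ≈⟨ ∑-cong (upTo #n) (λ n → ∑-comm (upTo (suc M)) (L n) _) ⟩
    ∑[ n < #n ] ∑[ ps ∈ L n ] ∑[ i < suc M ] ind (j ≤ᵇ i) (term i n ps)
      ≈⟨ ∑-cong (upTo #n) (λ n → ∑-cong (L n) λ ps → ∑-powers-chainTerm n ps j≤M) ⟩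
    ∑[ n < #n ] ∑[ ps ∈ L n ] powR z j * chainTerm n M j ps
      ≈⟨ ∑-cong (upTo #n) (λ n → *-distribˡ-∑ (L n) _ _) ⟨
    ∑[ n < #n ] powR z j * ∑ (L n) (chainTerm n M j)
      ≈⟨ *-distribˡ-∑ (upTo #n) _ _ ⟨
    powR z j * (∑[ n < #n ] ∑ (L n) (chainTerm n M j))
      ≈⟨ *-congˡ (∑-cong (upTo #n) λ n → ∑-chainTerm n M j) ⟩
    powR z j * totalChainSum M j ∎
    where
    #n : ℕ
    #n = suc (suc M)
    L : ℕ → List (List (ℕ × ℕ))
    L n = listsOf n (pairsUpTo M)
    term : ℕ → ℕ → List (ℕ × ℕ) → Carrier
    term i n ps = ind (chainᵇ j M ps) (ind (weight ps ≡ᵇ i ∸ j) (signedTerm n ps * powR z i))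

    expand : ∀ i → coeff ℓ (suc M) i j * powR z i ≈ ∑[ n < #n ] ∑[ ps ∈ L n ] term i n ps
    expand i = trans (*-congʳ (coeff-as-∑ M i j))
                     (trans (*-distribʳ-∑ (upTo #n) _ _) (∑-cong (upTo #n) λ n →
                       trans (*-distribʳ-∑ (L n) _ _) (∑-cong (L n) λ ps →
                         trans (ind-* (chainᵇ j M ps) _ _)
                               (ind-cong (chainᵇ j M ps) (ind-* (weight ps ≡ᵇ i ∸ j) _ _)))))

  closedForm-solution : ∀ x M → closedForm ℓ x z (suc M) ≈ Recurrence.solution R φ (λ j → xx x j * powR z j) M
  closedForm-solution x M = begin
    closedForm ℓ x z (suc M)
      ≈⟨ ∑<-cong (suc M) (λ i i≤M → ∑<-ind-≤ (term i) i≤M) ⟨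
    ∑[ i < suc M ] ∑[ j < suc M ] ind (j ≤ᵇ i) (term i j)
      ≈⟨ ∑-comm (upTo (suc M)) (upTo (suc M)) (λ i j → ind (j ≤ᵇ i) (term i j)) ⟩
    ∑[ j < suc M ] ∑[ i < suc M ] ind (j ≤ᵇ i) (term i j)
      ≈⟨ ∑<-cong (suc M) (λ j j<1+M → factor j (ℕₚ.≤-pred j<1+M)) ⟩
    ∑[ j < suc M ] xx x j * powR z j * totalChainSum M j ∎
    where
    term : ℕ → ℕ → Carrier
    term i j = coeff ℓ (suc M) i j * xx x j * powR z i

    factor : ∀ j → j ≤ M → ∑[ i < suc M ] ind (j ≤ᵇ i) (term i j) ≈ xx x j * powR z j * totalChainSum M j
    factor j j≤M = begin
      ∑[ i < suc M ] ind (j ≤ᵇ i) (term i j)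
        ≈⟨ ∑-cong (upTo (suc M)) (λ i → trans (ind-cong (j ≤ᵇ i) (trans (*-congʳ (*-comm _ _)) (*-assoc _ _ _)))
                                              (sym (*-ind (j ≤ᵇ i) _ _))) ⟩
      ∑[ i < suc M ] xx x j * ind (j ≤ᵇ i) (coeff ℓ (suc M) i j * powR z i)
        ≈⟨ *-distribˡ-∑ (upTo (suc M)) _ _ ⟨
      xx x j * (∑[ i < suc M ] ind (j ≤ᵇ i) (coeff ℓ (suc M) i j * powR z i))
        ≈⟨ *-congˡ (∑-coeff-powers M j j≤M) ⟩
      xx x j * (powR z j * totalChainSum M j)
        ≈⟨ *-assoc _ _ _ ⟨
      xx x j * powR z j * totalChainSum M j ∎

  -‿recSum : ∀ r M → - recSum ℓ z r M ≈ ∑[ k < M ] φ k M * r (suc k)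
  -‿recSum r M = trans (-‿distrib-∑ (upTo M) _) (∑-cong (upTo M) λ k → -‿distribˡ-* _ _)

lemma6p11 : (Γ : Graph) (d : ℕ) (ℓ : ℕ → ℕ)
    → let open Graph Γ using (n) in let open GraphDefs Γ in
      Σ (Subset n) (λ σ → IsClique σ × ∣ σ ∣ ≡ d)
    → (∀ (σ : Subset n) → IsClique σ → ∣ σ ∣ ≤ d)
    → (∀ (σ : Subset n) → IsClique σ → linkSize σ ≡ ℓ ∣ σ ∣)
    → ∀ {c ℓr : Level} (R : CommutativeRing c ℓr) (x : ℕ → CommutativeRing.Carrier R)
        (z : CommutativeRing.Carrier R) (r : ℕ → CommutativeRing.Carrier R)
    → let open CommutativeRing R in let open RingDefs R in
      r 1 ≈ 1#
    → (∀ m → 1 ≤ m → m ≤ d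
         → r (suc m) ≈ (r m + x m * powR z m) - recSum ℓ z r m)
    → ∀ m → 1 ≤ m → m ≤ suc d → r m ≈ closedForm ℓ x z m
lemma6p11 Γ d ℓ _ _ _ R x z r r₁ r-rec (suc M) _ 1+M≤1+d = begin
  r (suc M)                ≈⟨ solution-unique (r ∘ suc) d r₁′ recurrence M (ℕₚ.≤-pred 1+M≤1+d) ⟩
  solution M               ≈⟨ closedForm-solution x M ⟨
  closedForm ℓ x z (suc M) ∎
  where
  open CommutativeRing R hiding (zero)
  open RingDefs R
  open Sums R using (∑<)
  open ClosedForm R ℓ z
  open Recurrence R φ (λ j → xx x j * powR z j)
  open import Relation.Binary.Reasoning.Setoid setoid

  r₁′ : r 1 ≈ 1# * 1#
  r₁′ = trans r₁ (sym (*-identityʳ 1#))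

  recurrence : ∀ M → M < d →
    r (suc (suc M)) ≈ (r (suc M) + x (suc M) * powR z (suc M)) + ∑< (suc M) (λ k → φ k (suc M) * r (suc k))
  recurrence M M<d = trans (r-rec (suc M) (s≤s z≤n) M<d) (+-congˡ (-‿recSum r (suc M)))
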